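{- Let $\mathbb{A}$ be a perfect relevant algebra and let $\mathbb{A}_{\bullet}=\langle J^{\infty}(\mathbb{A}),O_{\mathbf{t}},R_{\circ},\ast_{\mathord{\sim}}\rangle$ be its prime structure. Then $\mathbb{A}_{\bullet}$ is a Routley-Meyer frame. Moreover, the relation $\preceq$ of $\mathbb{A}_{\bullet}$ (given by $u\preceq v$ iff $R_{\circ}ouv$ for some $o\in O_{\mathbf{t}}$) coincides with the reverse lattice order $\ge$ of $\mathbb{A}$ restricted to $J^{\infty}(\mathbb{A})$.
   Context: A relevant algebra is a structure $\mathbb{A}=\langle A,\wedge,\vee,\circ,\to,\mathord{\sim},\mathbf{t},\top,\bot\rangle$ such that: $\langle A,\wedge,\vee,\top,\bot\rangle$ is a bounded distributive lattice; $a\circ(b\vee c)=(a\circ b)\vee(a\circ c)$ and $(b\vee c)\circ a=(b\circ a)\vee(c\circ a)$; $\mathord{\sim}(a\vee b)=\mathord{\sim}a\wedge\mathord{\sim}b$ and $\mathord{\sim}(a\wedge b)=\mathord{\sim}a\vee\mathord{\sim}b$; $\mathord{\sim}\top=\bot$, $\mathord{\sim}\bot=\top$; $a\circ\bot=\bot\circ a=\bot$; $\mathbf{t}\circ a=a$; and $a\circ b\le c$ iff $a\le b\to c$. $J^{\infty}(\mathbb{A})$ and $M^{\infty}(\mathbb{A})$ denote the sets of completely join-irreducible and completely meet-irreducible elements. A relevant algebra is perfect if its lattice reduct is complete, completely distributive, join-generated by $J^{\infty}(\mathbb{A})$ and meet-generated by $M^{\infty}(\mathbb{A})$, and $\circ$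 preserves arbitrary joins in each coordinate, $\to$ turns arbitrary joins in the first coordinate into meets and preserves arbitrary meets in the second, and $\mathord{\sim}$ turns arbitrary joins into meets and arbitrary meets into joins. In a perfect relevant algebra, $\mathord{\sim}^{\sharp}$ is the map with $a\le\mathord{\sim}b$ iff $b\le\mathord{\sim}^{\sharp}a$, and $\lambda:M^{\infty}(\mathbb{A})\to J^{\infty}(\mathbb{A})$ is $\lambda(m)=\bigwedge\{u\in A\mid u\not\le m\}$. The prime structure $\mathbb{A}_{\bullet}=\langle J^{\infty}(\mathbb{A}),O_{\mathbf{t}},R_{\circ},\ast_{\mathord{\sim}}\rangle$ has: $R_{\circ}abc$ iff $c\le a\circ b$; $O_{\mathbf{t}}=\{j\in J^{\infty}(\mathbb{A})\mid j\le\mathbf{t}\}$; $a^{\ast_{\mathord{\sim}}}=\lambda(\mathord{\sim}^{\sharp}a)$. A relevance frame is a tuple $\langle W,O,R,{}^\ast\rangle$ with $W\neq\emptyset$, $O\subseteq W$, $R\subseteq W^3$, ${}^\ast:W\to W$; define $u\preceq v$ iff $\exists o\in O$ with $Rouv$. A Routley-Meyer frame is a relevance frame such that for all $u,v,x,y$: (1) $x\preceq x$; (2) $x\preceq y$ and $Ryuv$ imply $Rxuv$; (3) $x\preceq y$ and $Ruyv$ imply $Ruxv$; (4) $x\preceq y$ and $Ruvx$ imply $Ruvy$; (5) $x\preceq y$ implies $y^\ast\preceq x^\ast$; (6) $O$ is upward closed with respect to $\preceq$. -}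

module Defs where

open import Level using (0ℓ; Lift; lift; lower)
import Level
open import Data.Product using (Σ; ∃; _×_; _,_; proj₁; proj₂)
open import Relation.Binary.PropositionalEquality using (_≡_)
open import Relation.Binary.Core using (Rel)
open import Relation.Binary.Lattice.Structures using (IsDistributiveLattice)
open import Relation.Binary.Definitions using (Maximum; Minimum)
open import Relation.Nullary using (¬_)
open import Function.Bundles using (_⇔_)

record RelevantAlgebra : Set₁ where
  infixr 6 _∨_
  infixr 7 _∧_
  infixr 8 _∘_
  infixr 5 _⇒_
  infix 4 _≤_
  field
    Carrier : Set
    _≤_     : Rel Carrier 0ℓ
    _∧_ _∨_ _∘_ _⇒_ : Carrier → Carrier → Carrier
    ∼       : Carrier → Carrier
    t ⊤ ⊥   : Carrier
    isDistributiveLattice : IsDistributiveLattice _≡_ _≤_ _∨_ _∧_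
    maximum : Maximum _≤_ ⊤
    minimum : Minimum _≤_ ⊥
    ∘-distribˡ-∨ : ∀ a b c → a ∘ (b ∨ c) ≡ (a ∘ b) ∨ (a ∘ c)
    ∘-distribʳ-∨ : ∀ a b c → (b ∨ c) ∘ a ≡ (b ∘ a) ∨ (c ∘ a)
    ∼-∨ : ∀ a b → ∼ (a ∨ b) ≡ ∼ a ∧ ∼ b
    ∼-∧ : ∀ a b → ∼ (a ∧ b) ≡ ∼ a ∨ ∼ b
    ∼-⊤ : ∼ ⊤ ≡ ⊥
    ∼-⊥ : ∼ ⊥ ≡ ⊤
    ∘-⊥ʳ : ∀ a → a ∘ ⊥ ≡ ⊥
    ∘-⊥ˡ : ∀ a → ⊥ ∘ a ≡ ⊥
    t-identityˡ : ∀ a → t ∘ a ≡ a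
    residuation : ∀ a b c → (a ∘ b ≤ c) ⇔ (a ≤ b ⇒ c)

-- Arbitrary joins/meets are taken over
-- families indexed by an arbitrary type I : Set₁ (this covers all
-- subsets S : Carrier → Set of A, via ⋁ₛ/⋀ₛ below, as well as the
-- large index sets needed for J∞ and M∞).

module _ (A : RelevantAlgebra) where
  open RelevantAlgebra A

  IsUpperBound : {I : Set₁} → (I → Carrier) → Carrier → Set₁
  IsUpperBound f u = ∀ i → f i ≤ u

  IsLowerBound : {I : Set₁} → (I → Carrier) → Carrier → Set₁
  IsLowerBound f l = ∀ i → l ≤ f i

  record IsPerfect : Set₂ where
    field
      ⋁ : {I : Set₁} → (I → Carrier) → Carrier
      ⋀ : {I : Set₁} → (I → Carrier) → Carrier
      ⋁-upper : {I : Set₁} (f : I → Carrier) → IsUpperBound f (⋁ f)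
      ⋁-least : {I : Set₁} (f : I → Carrier) (u : Carrier) → IsUpperBound f u → ⋁ f ≤ u
      ⋀-lower : {I : Set₁} (f : I → Carrier) → IsLowerBound f (⋀ f)
      ⋀-greatest : {I : Set₁} (f : I → Carrier) (l : Carrier) → IsLowerBound f l → l ≤ ⋀ f

    ⋁ₛ : (Carrier → Set) → Carrier
    ⋁ₛ S = ⋁ (λ (p : Lift (Level.suc 0ℓ) (Σ Carrier S)) → proj₁ (lower p))

    ⋀ₛ : (Carrier → Set) → Carrier
    ⋀ₛ S = ⋀ (λ (p : Lift (Level.suc 0ℓ) (Σ Carrier S)) → proj₁ (lower p))

    CJI : Carrier → Set₁
    CJI j = (S : Carrier → Set) → j ≡ ⋁ₛ S → S j

    CMI : Carrier → Set₁
    CMI m = (S : Carrier → Set) → m ≡ ⋀ₛ S → S m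

    field
      completelyDistributive :
        (I : Set₁) (J : I → Set₁) (a : (i : I) → J i → Carrier) →
        ⋀ (λ i → ⋁ (λ j → a i j)) ≡ ⋁ (λ (φ : (i : I) → J i) → ⋀ (λ i → a i (φ i)))
      joinGenerated : ∀ a → a ≡ ⋁ (λ (p : Σ Carrier (λ j → CJI j × j ≤ a)) → proj₁ p)
      meetGenerated : ∀ a → a ≡ ⋀ (λ (p : Σ Carrier (λ m → CMI m × a ≤ m)) → proj₁ p)
      ∘-⋁ˡ : {I : Set₁} (f : I → Carrier) (b : Carrier) → ⋁ f ∘ b ≡ ⋁ (λ i → f i ∘ b)
      ∘-⋁ʳ : {I : Set₁} (a : Carrier) (f : I → Carrier) → a ∘ ⋁ f ≡ ⋁ (λ i → a ∘ f i)
      ⇒-⋁ˡ : {I : Set₁} (f : I → Carrier) (b : Carrier) → (⋁ f ⇒ b) ≡ ⋀ (λ i → f i ⇒ b)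
      ⇒-⋀ʳ : {I : Set₁} (a : Carrier) (f : I → Carrier) → (a ⇒ ⋀ f) ≡ ⋀ (λ i → a ⇒ f i)
      ∼-⋁ : {I : Set₁} (f : I → Carrier) → ∼ (⋁ f) ≡ ⋀ (λ i → ∼ (f i))
      ∼-⋀ : {I : Set₁} (f : I → Carrier) → ∼ (⋀ f) ≡ ⋁ (λ i → ∼ (f i))

record Frame : Set₂ where
  field
    W    : Set₁
    O    : W → Set
    R    : W → W → W → Set
    star : W → W

module _ (F : Frame) where
  open Frame F

  _⪯_ : W → W → Set₁
  u ⪯ v = ∃ λ o → O o × R o u v

  -- a relevance frame requires W ≠ ∅
  IsRelevanceFrame : Set₁
  IsRelevanceFrame = W

  record IsRoutleyMeyer : Set₁ where
    field
      relevanceFrame : IsRelevanceFrame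
      ⪯-refl  : ∀ x → x ⪯ x
      cond2   : ∀ x y u v → x ⪯ y → R y u v → R x u v
      cond3   : ∀ x y u v → x ⪯ y → R u y v → R u x v
      cond4   : ∀ x y u v → x ⪯ y → R u v x → R u v y
      cond5   : ∀ x y → x ⪯ y → star y ⪯ star x
      O-upper : ∀ x y → x ⪯ y → O x → O y

module PrimeStructure (A : RelevantAlgebra) (P : IsPerfect A) where
  open RelevantAlgebra A
  open IsPerfect P

  J∞ : Set₁
  J∞ = Σ Carrier CJI

  -- ∼♯ a = ⋁ { b | a ≤ ∼ b }  (the map with a ≤ ∼ b iff b ≤ ∼♯ a)
  ∼♯ : Carrier → Carrier
  ∼♯ a = ⋁ₛ (λ b → a ≤ ∼ b)

  lam : Carrier → Carrier
  lam m = ⋀ₛ (λ u → ¬ (u ≤ m))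

  Oₜ : J∞ → Set
  Oₜ j = proj₁ j ≤ t

  R∘ : J∞ → J∞ → J∞ → Set
  R∘ a b c = proj₁ c ≤ proj₁ a ∘ proj₁ b

  primeStructure : (J∞ → J∞) → Frame
  primeStructure s = record { W = J∞ ; O = Oₜ ; R = R∘ ; star = s }

-- Everything reduces to the dictionary between R∘ and the lattice order.  For
-- u, v ∈ J∞ we have v ≤ t ∘ u = ⋁ {j ∘ u | j ∈ J∞, j ≤ t}, and complete join
-- irreducibles are completely join prime in a completely distributive lattice,
-- so u ⪯ v iff v ≤ u.  Conditions (1)–(4) and (6) then follow from
-- monotonicity of ∘.  For (5), ∼♯ sends join primes to meet primes and λ sends
-- meet primes back to join primes, so a ↦ λ(∼♯ a) is an antitone map on J∞.
module Submission where

open import Defs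
open import Axiom.ExcludedMiddle using (ExcludedMiddle)
open import Level using (0ℓ; Lift; lift; lower)
import Level
open import Data.Bool using (Bool; true; false)
open import Data.Empty using (⊥-elim)
open import Data.Product using (Σ; ∃; _×_; _,_; proj₁; proj₂)
open import Data.Unit using (tt) renaming (⊤ to Unit)
open import Function.Bundles using (_⇔_; mk⇔; Equivalence)
open import Relation.Binary.Lattice.Bundles using (Lattice)
open import Relation.Binary.Lattice.Structures using (IsDistributiveLattice)
import Relation.Binary.Lattice.Properties.JoinSemilattice as JoinSemilatticeProperties
import Relation.Binary.Reasoning.PartialOrder as PartialOrderReasoning
open import Relation.Binary.PropositionalEquality using (_≡_; refl; sym; trans; cong; subst)
open import Relation.Nullary using (¬_; yes; no)
open import Relation.Nullary.Decidable using (True; toWitness; fromWitness)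

module RelevantAlgebraProperties (A : RelevantAlgebra) where
  open RelevantAlgebra A

  lattice : Lattice 0ℓ 0ℓ 0ℓ
  lattice = record { isLattice = IsDistributiveLattice.isLattice isDistributiveLattice }

  open Lattice lattice public
    using (antisym; x≤x∨y; x∧y≤x; x∧y≤y; ∧-greatest; poset)
    renaming (refl to ≤-refl; trans to ≤-trans; reflexive to ≤-reflexive)
  open JoinSemilatticeProperties (Lattice.joinSemilattice lattice) using (x≤y⇒x∨y≈y)
  open PartialOrderReasoning poset

  ∘-monoˡ : ∀ c {a b} → a ≤ b → a ∘ c ≤ b ∘ c
  ∘-monoˡ c {a} {b} a≤b = begin
    a ∘ c           ≤⟨ x≤x∨y _ _ ⟩
    a ∘ c ∨ b ∘ c   ≡⟨ sym (∘-distribʳ-∨ c a b) ⟩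
    (a ∨ b) ∘ c     ≡⟨ cong (_∘ c) (x≤y⇒x∨y≈y a≤b) ⟩
    b ∘ c           ∎

  ∘-monoʳ : ∀ c {a b} → a ≤ b → c ∘ a ≤ c ∘ b
  ∘-monoʳ c {a} {b} a≤b = begin
    c ∘ a           ≤⟨ x≤x∨y _ _ ⟩
    c ∘ a ∨ c ∘ b   ≡⟨ sym (∘-distribˡ-∨ c a b) ⟩
    c ∘ (a ∨ b)     ≡⟨ cong (c ∘_) (x≤y⇒x∨y≈y a≤b) ⟩
    c ∘ b           ∎

  ∼-antitone : ∀ {a b} → a ≤ b → ∼ b ≤ ∼ a
  ∼-antitone {a} {b} a≤b = begin
    ∼ b             ≡⟨ cong ∼ (sym (x≤y⇒x∨y≈y a≤b)) ⟩
    ∼ (a ∨ b)       ≡⟨ ∼-∨ a b ⟩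
    ∼ a ∧ ∼ b       ≤⟨ x∧y≤x _ _ ⟩
    ∼ a             ∎

module PerfectProperties (A : RelevantAlgebra) (P : IsPerfect A) where
  open RelevantAlgebra A
  open IsPerfect P
  open PrimeStructure A P
  open RelevantAlgebraProperties A
  open PartialOrderReasoning poset

  CompletelyJoinPrime : Carrier → Set₂
  CompletelyJoinPrime a = ∀ {I : Set₁} (f : I → Carrier) → a ≤ ⋁ f → ∃ λ i → a ≤ f i

  CompletelyMeetPrime : Carrier → Set₂
  CompletelyMeetPrime m = ∀ {I : Set₁} (f : I → Carrier) → ⋀ f ≤ m → ∃ λ i → f i ≤ m

  ⋁ₛ-upper : ∀ {S b} → S b → b ≤ ⋁ₛ S
  ⋁ₛ-upper {b = b} Sb = ⋁-upper _ (lift (b , Sb))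

  ⋁ₛ-least : ∀ S u → (∀ {b} → S b → b ≤ u) → ⋁ₛ S ≤ u
  ⋁ₛ-least S u bound = ⋁-least _ u (λ p → bound (proj₂ (lower p)))

  ⋀ₛ-lower : ∀ {S b} → S b → ⋀ₛ S ≤ b
  ⋀ₛ-lower {b = b} Sb = ⋀-lower _ (lift (b , Sb))

  ⋀ₛ-greatest : ∀ S l → (∀ {b} → S b → l ≤ b) → l ≤ ⋀ₛ S
  ⋀ₛ-greatest S l bound = ⋀-greatest _ l (λ p → bound (proj₂ (lower p)))

  completelyJoinPrime⇒CJI : ∀ {a} → CompletelyJoinPrime a → CJI a
  completelyJoinPrime⇒CJI {a} prime S a≡⋁S with prime _ (≤-reflexive a≡⋁S)
  ... | lift (b , Sb) , a≤b = subst S b≡a Sb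
    where
    b≡a : b ≡ a
    b≡a = antisym (≤-trans (⋁ₛ-upper Sb) (≤-reflexive (sym a≡⋁S))) a≤b

  -- The two-element family {a, ⋁ f} turns complete distributivity into
  -- infinite distributivity of ∧ over ⋁.
  ∧-distribˡ-⋁ : ∀ a {I : Set₁} (f : I → Carrier) → a ∧ ⋁ f ≤ ⋁ (λ i → a ∧ f i)
  ∧-distribˡ-⋁ a {I} f = begin
    a ∧ ⋁ f                            ≤⟨ ⋀-greatest _ _ ≤join ⟩
    ⋀ (λ b → ⋁ (λ i → pair b i))       ≡⟨ completelyDistributive _ Index pair ⟩
    ⋁ (λ φ → ⋀ (λ b → pair b (φ b)))   ≤⟨ ⋁-least _ _ (λ φ → ≤-trans (meet≤ φ) (⋁-upper _ (φ (lift false)))) ⟩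
    ⋁ (λ i → a ∧ f i)                  ∎
    where
    Index : Lift (Level.suc 0ℓ) Bool → Set₁
    Index (lift true)  = Lift (Level.suc 0ℓ) Unit
    Index (lift false) = I
    pair : (b : Lift (Level.suc 0ℓ) Bool) → Index b → Carrier
    pair (lift true)  _ = a
    pair (lift false) i = f i
    ≤join : ∀ b → a ∧ ⋁ f ≤ ⋁ (pair b)
    ≤join (lift true)  = ≤-trans (x∧y≤x _ _) (⋁-upper _ (lift tt))
    ≤join (lift false) = x∧y≤y _ _
    meet≤ : (φ : ∀ b → Index b) → ⋀ (λ b → pair b (φ b)) ≤ a ∧ f (φ (lift false))
    meet≤ φ = ∧-greatest (⋀-lower _ (lift true)) (⋀-lower _ (lift false))

  ∼♯-galois : ∀ a b → a ≤ ∼ b ⇔ b ≤ ∼♯ a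
  ∼♯-galois a b = mk⇔ ⋁ₛ-upper to
    where
    a≤∼∼♯a : a ≤ ∼ (∼♯ a)
    a≤∼∼♯a = begin
      a                               ≤⟨ ⋀-greatest _ a (λ p → proj₂ (lower p)) ⟩
      ⋀ (λ p → ∼ (proj₁ (lower p)))   ≡⟨ sym (∼-⋁ _) ⟩
      ∼ (∼♯ a)                        ∎
    to : b ≤ ∼♯ a → a ≤ ∼ b
    to b≤∼♯a = ≤-trans a≤∼∼♯a (∼-antitone b≤∼♯a)

  ∼♯-antitone : ∀ {a b} → a ≤ b → ∼♯ b ≤ ∼♯ a
  ∼♯-antitone a≤b = ⋁ₛ-least _ _ (λ b≤∼c → ⋁ₛ-upper (≤-trans a≤b b≤∼c))

  lam-monotone : ∀ {m n} → m ≤ n → lam m ≤ lam n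
  lam-monotone m≤n = ⋀ₛ-greatest _ _ (λ u≰n → ⋀ₛ-lower (λ u≤m → u≰n (≤-trans u≤m m≤n)))

  ∼♯-completelyMeetPrime : ∀ {a} → CompletelyJoinPrime a → CompletelyMeetPrime (∼♯ a)
  ∼♯-completelyMeetPrime {a} prime f ⋀f≤∼♯a with prime (λ i → ∼ (f i)) a≤⋁∼f
    where
    a≤⋁∼f : a ≤ ⋁ (λ i → ∼ (f i))
    a≤⋁∼f = begin
      a                   ≤⟨ Equivalence.from (∼♯-galois a _) ⋀f≤∼♯a ⟩
      ∼ (⋀ f)             ≡⟨ ∼-⋀ f ⟩
      ⋁ (λ i → ∼ (f i))   ∎
  ... | i , a≤∼fi = i , Equivalence.to (∼♯-galois a (f i)) a≤∼fi

  lam≰ : ∀ {m} → CompletelyMeetPrime m → ¬ (lam m ≤ m)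
  lam≰ prime lam≤m with prime _ lam≤m
  ... | lift (_ , u≰m) , u≤m = u≰m u≤m

  primeStructure-⪯⇒≥ : ∀ s u v → _⪯_ (primeStructure s) u v → proj₁ v ≤ proj₁ u
  primeStructure-⪯⇒≥ s u v (o , o≤t , v≤o∘u) = begin
    proj₁ v             ≤⟨ v≤o∘u ⟩
    proj₁ o ∘ proj₁ u   ≤⟨ ∘-monoˡ _ o≤t ⟩
    t ∘ proj₁ u         ≡⟨ t-identityˡ _ ⟩
    proj₁ u             ∎

module ClassicalPerfectProperties
  (em0 : ExcludedMiddle 0ℓ) (em1 : ExcludedMiddle (Level.suc 0ℓ))
  (A : RelevantAlgebra) (P : IsPerfect A) where
  open RelevantAlgebra A
  open IsPerfect P
  open PrimeStructure A P
  open RelevantAlgebraProperties A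
  open PerfectProperties A P
  open PartialOrderReasoning poset

  -- Excluded middle shrinks the image of a Set₁-indexed family to a Set-valued predicate.
  ⋁≡⋁ₛ-image : ∀ {I : Set₁} (g : I → Carrier) →
               ⋁ g ≡ ⋁ₛ (λ b → True (em1 {∃ λ i → b ≡ g i}))
  ⋁≡⋁ₛ-image g = antisym
    (⋁-least _ _ (λ i → ⋁ₛ-upper (fromWitness (i , refl))))
    (⋁ₛ-least _ _ (λ {b} b∈image → let i , b≡gi = toWitness {a? = em1 {∃ λ i → b ≡ g i}} b∈image
                                   in ≤-trans (≤-reflexive b≡gi) (⋁-upper g i)))

  CJI-⋁ : ∀ {a} → CJI a → ∀ {I : Set₁} (g : I → Carrier) → a ≡ ⋁ g → ∃ λ i → a ≡ g i
  CJI-⋁ irreducible g a≡⋁g =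
    toWitness (irreducible _ (trans a≡⋁g (⋁≡⋁ₛ-image g)))

  CJI⇒completelyJoinPrime : ∀ {a} → CJI a → CompletelyJoinPrime a
  CJI⇒completelyJoinPrime {a} irreducible f a≤⋁f
    with CJI-⋁ irreducible (λ i → a ∧ f i) (antisym a≤⋁a∧f (⋁-least _ _ (λ i → x∧y≤x _ _)))
    where
    a≤⋁a∧f : a ≤ ⋁ (λ i → a ∧ f i)
    a≤⋁a∧f = ≤-trans (∧-greatest ≤-refl a≤⋁f) (∧-distribˡ-⋁ a f)
  ... | i , a≡a∧fi = i , ≤-trans (≤-reflexive a≡a∧fi) (x∧y≤y _ _)

  lam-completelyJoinPrime : ∀ {m} → CompletelyMeetPrime m → CompletelyJoinPrime (lam m)
  lam-completelyJoinPrime {m} prime {I} f lam≤⋁f with em1 {∃ λ i → ¬ (f i ≤ m)}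
  ... | yes (i , fi≰m) = i , ⋀ₛ-lower fi≰m
  ... | no ∄fi≰m = ⊥-elim (lam≰ prime (≤-trans lam≤⋁f (⋁-least f m fi≤m)))
    where
    fi≤m : ∀ i → f i ≤ m
    fi≤m i with em0 {f i ≤ m}
    ... | yes fi≤m = fi≤m
    ... | no fi≰m = ⊥-elim (∄fi≰m (i , fi≰m))

  ast : J∞ → J∞
  ast (a , irreducible) =
    lam (∼♯ a) ,
    completelyJoinPrime⇒CJI (lam-completelyJoinPrime (∼♯-completelyMeetPrime (CJI⇒completelyJoinPrime irreducible)))

  primeStructure-⪯⇔≥ : ∀ s u v → _⪯_ (primeStructure s) u v ⇔ (proj₁ v ≤ proj₁ u)
  primeStructure-⪯⇔≥ s u v = mk⇔ (primeStructure-⪯⇒≥ s u v) from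
    where
    J∞≤t : Set₁
    J∞≤t = Σ Carrier (λ j → CJI j × j ≤ t)
    below-t∘u : J∞≤t → Carrier
    below-t∘u (j , _) = j ∘ proj₁ u
    from : proj₁ v ≤ proj₁ u → _⪯_ (primeStructure s) u v
    from v≤u with CJI⇒completelyJoinPrime (proj₂ v) below-t∘u (begin
      proj₁ v                                ≤⟨ v≤u ⟩
      proj₁ u                                ≡⟨ sym (t-identityˡ _) ⟩
      t ∘ proj₁ u                            ≡⟨ cong (_∘ proj₁ u) (joinGenerated t) ⟩
      ⋁ (λ (j : J∞≤t) → proj₁ j) ∘ proj₁ u   ≡⟨ ∘-⋁ˡ _ _ ⟩
      ⋁ below-t∘u                            ∎)
    ... | (j , irreducible , j≤t) , v≤j∘u = (j , irreducible) , j≤t , v≤j∘u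

  J∞-inhabited : ¬ (⊤ ≡ ⊥) → J∞
  J∞-inhabited ⊤≢⊥ with em1 {J∞}
  ... | yes j = j
  ... | no ∄j = ⊥-elim (⊤≢⊥ (antisym ⊤≤⊥ (minimum ⊤)))
    where
    ⊤≤⊥ : ⊤ ≤ ⊥
    ⊤≤⊥ = ≤-trans (≤-reflexive (joinGenerated ⊤))
                  (⋁-least _ ⊥ (λ (j , irreducible , _) → ⊥-elim (∄j (j , irreducible))))

  primeStructure-isRoutleyMeyer : ¬ (⊤ ≡ ⊥) → IsRoutleyMeyer (primeStructure ast)
  primeStructure-isRoutleyMeyer ⊤≢⊥ = record
    { relevanceFrame = J∞-inhabited ⊤≢⊥
    ; ⪯-refl  = λ x → ≥⇒⪯ x x ≤-refl
    ; cond2   = λ x y u v x⪯y v≤y∘u → ≤-trans v≤y∘u (∘-monoˡ _ (⪯⇒≥ x y x⪯y))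
    ; cond3   = λ x y u v x⪯y v≤u∘y → ≤-trans v≤u∘y (∘-monoʳ _ (⪯⇒≥ x y x⪯y))
    ; cond4   = λ x y u v x⪯y → ≤-trans (⪯⇒≥ x y x⪯y)
    ; cond5   = λ x y x⪯y → ≥⇒⪯ (ast y) (ast x) (lam-monotone (∼♯-antitone (⪯⇒≥ x y x⪯y)))
    ; O-upper = λ x y x⪯y → ≤-trans (⪯⇒≥ x y x⪯y)
    }
    where
    ⪯⇒≥ : ∀ u v → _⪯_ (primeStructure ast) u v → proj₁ v ≤ proj₁ u
    ⪯⇒≥ u v = Equivalence.to (primeStructure-⪯⇔≥ ast u v)
    ≥⇒⪯ : ∀ u v → proj₁ v ≤ proj₁ u → _⪯_ (primeStructure ast) u v
    ≥⇒⪯ u v = Equivalence.from (primeStructure-⪯⇔≥ ast u v)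

lemma2 : ExcludedMiddle 0ℓ → ExcludedMiddle (Level.suc 0ℓ) →
    (A : RelevantAlgebra) (P : IsPerfect A) →
    ¬ (RelevantAlgebra.⊤ A ≡ RelevantAlgebra.⊥ A) →
    let open RelevantAlgebra A
        open PrimeStructure A P
    in Σ (J∞ → J∞) λ ast →
         (∀ a → proj₁ (ast a) ≡ lam (∼♯ (proj₁ a)))
         × IsRoutleyMeyer (primeStructure ast)
         × (∀ u v → _⪯_ (primeStructure ast) u v ⇔ (proj₁ v ≤ proj₁ u))
lemma2 em0 em1 A P ⊤≢⊥ =
  ast , (λ _ → refl) , primeStructure-isRoutleyMeyer ⊤≢⊥ , primeStructure-⪯⇔≥ ast
  where open ClassicalPerfectProperties em0 em1 A P
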